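{- Let $G$ be a finite, simple, connected graph such that every vertex of $G$ is an endpoint of some path of length $2$. Then $G$ is bipartite if and only if $\chi_2(G)=2$.
   Context: All graphs are finite, simple and connected. A path of length $t$ is a sequence $v_1,\ldots,v_{t+1}$ of distinct vertices with $v_j\sim v_{j+1}$ for all $j$; its endpoints are $v_1$ and $v_{t+1}$. A (not necessarily proper) colouring of the vertices of $G$ is $t$-periodic if every path of length $t$ in $G$ has endpoints of the same colour. The vertex $t$-periodic colouring number $\chi_t(G)$ is the largest $k$ such that $G$ has a $t$-periodic colouring of the vertices using exactly $k$ colours. -}

module Defs where

open import Data.Nat using (ℕ; zero; suc; _≤_; NonZero)
open import Data.Fin using (Fin; zero; suc; inject₁; fromℕ)
open import Data.Bool using (Bool)
open import Data.Product using (Σ; ∃; ∃-syntax; _×_; _,_)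
open import Data.Sum using (_⊎_)
open import Relation.Binary.PropositionalEquality using (_≡_)
open import Relation.Nullary using (¬_)
open import Function.Definitions using (Injective; Surjective)

record SimpleGraph (n : ℕ) : Set₁ where
  field
    Adj   : Fin n → Fin n → Set
    sym   : ∀ {u v} → Adj u v → Adj v u
    irrefl : ∀ {v} → ¬ Adj v v
open SimpleGraph public

record Path {n : ℕ} (G : SimpleGraph n) (t : ℕ) : Set where
  field
    vert  : Fin (suc t) → Fin n
    inj   : Injective _≡_ _≡_ vert
    adj   : ∀ (j : Fin t) → Adj G (vert (inject₁ j)) (vert (suc j))
open Path public

start : ∀ {n} {G : SimpleGraph n} {t} → Path G t → Fin n
start p = vert p zero

end : ∀ {n} {G : SimpleGraph n} {t} → Path G t → Fin n
end {t = t} p = vert p (fromℕ t)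

Connected : ∀ {n} → SimpleGraph n → Set
Connected {n} G = NonZero n × (∀ (u v : Fin n) → ∃[ t ] Σ (Path G t) (λ p → start p ≡ u × end p ≡ v))

Bipartite : ∀ {n} → SimpleGraph n → Set
Bipartite {n} G = Σ (Fin n → Bool) (λ c → ∀ {u v : Fin n} → Adj G u v → ¬ (c u ≡ c v))

-- A colouring using exactly k colours: a surjection from the vertices onto Fin k.
-- It is t-periodic if every path of length t has endpoints of the same colour.
Periodic : ∀ {n} → SimpleGraph n → ℕ → ∀ {k} → (Fin n → Fin k) → Set
Periodic G t c = ∀ (p : Path G t) → c (start p) ≡ c (end p)

HasPeriodicColouring : ∀ {n} → SimpleGraph n → ℕ → ℕ → Set
HasPeriodicColouring {n} G t k =
  Σ (Fin n → Fin k) (λ c → Surjective _≡_ _≡_ c × Periodic G t c)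

IsChi : ∀ {n} → (t : ℕ) → SimpleGraph n → ℕ → Set
IsChi t G k = HasPeriodicColouring G t k × (∀ m → HasPeriodicColouring G t m → m ≤ k)

{-# OPTIONS --safe #-}
-- In a 2-periodic colouring two neighbours of a common vertex have the same
-- colour. Hence, for an edge ux, the property "w has colour c u and all its
-- neighbours have colour c x, or vice versa" passes from a vertex to its
-- neighbours, so by connectivity every vertex has colour c u or c x: at most
-- two colours occur, and if the edge ux is monochromatic only one does. Thus a
-- 2-periodic colouring with exactly two colours is a proper 2-colouring, and
-- conversely a proper 2-colouring is 2-periodic and, as G has an edge, uses
-- both colours.
module Submission where

open import Defs hiding (sym)
open import Data.Nat using (ℕ; zero; suc; _≤_)
open import Data.Fin using (Fin; zero; suc; inject₁; fromℕ) renaming (_≟_ to _≟ᶠ_)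
open import Data.Fin.Properties using (2↔Bool; injective⇒≤; 0≢1+n)
open import Data.Bool using (Bool)
open import Data.Bool.Properties using (¬-not) renaming (_≟_ to _≟ᵇ_)
open import Data.Product using (Σ; _×_; _,_; proj₁)
open import Data.Sum using (_⊎_; inj₁; inj₂)
open import Function.Base using (_∘_)
open import Function.Bundles using (_⇔_; mk⇔; Inverse; Injection; Surjection)
open import Function.Definitions using (Injective; Surjective)
open import Function.Properties.Inverse using (↔-sym; ↔⇒↣; ↔⇒↠)
import Function.Construct.Composition as Compose
open import Relation.Binary.PropositionalEquality
  using (_≡_; _≢_; refl; sym; trans; cong; module ≡-Reasoning)
open import Relation.Nullary using (¬_; yes; no)

private
  variable
    k : ℕ

≢-≢⇒≡ : {a b d : Bool} → a ≢ b → d ≢ b → a ≡ d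
≢-≢⇒≡ a≢b d≢b = trans (¬-not a≢b) (sym (¬-not d≢b))

≢⇒surjective : ∀ {a} {A : Set a} {f : A → Bool} {x y : A} →
  f x ≢ f y → Surjective _≡_ _≡_ f
≢⇒surjective {f = f} {x} {y} fx≢fy β with β ≟ᵇ f x
... | yes β≡fx = x , λ { refl → sym β≡fx }
... | no  β≢fx = y , λ { refl → ≢-≢⇒≡ (fx≢fy ∘ sym) β≢fx }

two-valued⇒≤2 : {A B : Fin k} → (∀ y → y ≡ A ⊎ y ≡ B) → k ≤ 2
two-valued⇒≤2 {k} {A} {B} two = injective⇒≤ side-injective
  where
  side : Fin k → Fin 2
  side y with two y
  ... | inj₁ _ = zero
  ... | inj₂ _ = suc zero

  side-injective : Injective _≡_ _≡_ side
  side-injective {y} {y′} _  with two y | two y′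
  side-injective refl | inj₁ y≡A | inj₁ y′≡A = trans y≡A (sym y′≡A)
  side-injective refl | inj₂ y≡B | inj₂ y′≡B = trans y≡B (sym y′≡B)
  side-injective ()   | inj₁ _   | inj₂ _
  side-injective ()   | inj₂ _   | inj₁ _

surjective⇒¬constant : ∀ {a} {A : Set a} {c : A → Fin 2} {K : Fin 2} →
  Surjective _≡_ _≡_ c → ¬ (∀ w → c w ≡ K)
surjective⇒¬constant {c = c} {K} sur constant
  with sur zero | sur (suc zero)
... | w₀ , c≡0 | w₁ , c≡1 = 0≢1+n (begin
  zero       ≡⟨ sym (c≡0 refl) ⟩
  c w₀       ≡⟨ constant w₀ ⟩
  K          ≡⟨ sym (constant w₁) ⟩
  c w₁       ≡⟨ c≡1 refl ⟩
  suc zero   ∎)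
  where open ≡-Reasoning

module _ {n : ℕ} (G : SimpleGraph n) where

  Adj⇒≢ : ∀ {u v} → Adj G u v → u ≢ v
  Adj⇒≢ uv refl = irrefl G uv

  path₂ : ∀ {a y b} → Adj G a y → Adj G y b → a ≢ b → Path G 2
  path₂ {a} {y} {b} ay yb a≢b = record { vert = vert₂ ; inj = vert₂-injective ; adj = adj₂ }
    where
    vert₂ : Fin 3 → Fin n
    vert₂ zero             = a
    vert₂ (suc zero)       = y
    vert₂ (suc (suc zero)) = b

    vert₂-injective : Injective _≡_ _≡_ vert₂
    vert₂-injective {zero}             {zero}             _ = refl
    vert₂-injective {suc zero}         {suc zero}         _ = refl
    vert₂-injective {suc (suc zero)}   {suc (suc zero)}   _ = refl
    vert₂-injective {zero}             {suc zero}         e with () ← Adj⇒≢ ay e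
    vert₂-injective {zero}             {suc (suc zero)}   e with () ← a≢b e
    vert₂-injective {suc zero}         {zero}             e with () ← Adj⇒≢ ay (sym e)
    vert₂-injective {suc zero}         {suc (suc zero)}   e with () ← Adj⇒≢ yb e
    vert₂-injective {suc (suc zero)}   {zero}             e with () ← a≢b (sym e)
    vert₂-injective {suc (suc zero)}   {suc zero}         e with () ← Adj⇒≢ yb (sym e)

    adj₂ : ∀ (j : Fin 2) → Adj G (vert₂ (inject₁ j)) (vert₂ (suc j))
    adj₂ zero       = ay
    adj₂ (suc zero) = yb

  AdjClosed : (Fin n → Set) → Set
  AdjClosed P = ∀ {w z} → Adj G w z → P w → P z

  walk-preserves : ∀ {P} → AdjClosed P → ∀ t (f : Fin (suc t) → Fin n) →
    (∀ j → Adj G (f (inject₁ j)) (f (suc j))) → P (f zero) → P (f (fromℕ t))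
  walk-preserves closed zero    f adjs Pf₀ = Pf₀
  walk-preserves closed (suc t) f adjs Pf₀ =
    walk-preserves closed t (f ∘ suc) (adjs ∘ suc) (closed (adjs zero) Pf₀)

  connected-preserves : ∀ {P} → Connected G → AdjClosed P → ∀ {u} → P u → ∀ w → P w
  connected-preserves (_ , joined) closed {u} Pu w with joined u w
  ... | t , p , refl , refl = walk-preserves closed t (vert p) (adj p) Pu

  module _ {c : Fin n → Fin k} (periodic : Periodic G 2 c) where

    common-neighbour⇒≡ : ∀ {y a b} → Adj G y a → Adj G y b → c a ≡ c b
    common-neighbour⇒≡ {a = a} {b} ya yb with a ≟ᶠ b
    ... | yes refl = refl
    ... | no  a≢b  = periodic (path₂ (SimpleGraph.sym G ya) yb a≢b)

    Alternating : Fin k → Fin k → Fin n → Set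
    Alternating A B w = (c w ≡ A × (∀ {z} → Adj G w z → c z ≡ B))
                      ⊎ (c w ≡ B × (∀ {z} → Adj G w z → c z ≡ A))

    alternating-closed : ∀ {A B} → AdjClosed (Alternating A B)
    alternating-closed wz (inj₁ (cw≡A , nbrs≡B)) =
      inj₂ (nbrs≡B wz , λ zz′ → trans (common-neighbour⇒≡ zz′ (SimpleGraph.sym G wz)) cw≡A)
    alternating-closed wz (inj₂ (cw≡B , nbrs≡A)) =
      inj₁ (nbrs≡A wz , λ zz′ → trans (common-neighbour⇒≡ zz′ (SimpleGraph.sym G wz)) cw≡B)

    colours-of-edge : Connected G → ∀ {u x} → Adj G u x → ∀ w → c w ≡ c u ⊎ c w ≡ c x
    colours-of-edge conn {u} {x} ux w
      with connected-preserves conn alternating-closed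
             (inj₁ (refl , λ uz → common-neighbour⇒≡ uz ux)) w
    ... | inj₁ (cw≡cu , _) = inj₁ cw≡cu
    ... | inj₂ (cw≡cx , _) = inj₂ cw≡cx

    monochromatic-edge⇒constant : Connected G → ∀ {u x} → Adj G u x → c u ≡ c x →
      ∀ w → c w ≡ c u
    monochromatic-edge⇒constant conn ux cu≡cx w with colours-of-edge conn ux w
    ... | inj₁ cw≡cu = cw≡cu
    ... | inj₂ cw≡cx = trans cw≡cx (sym cu≡cx)

  periodic₂-colours≤2 : Connected G → ∀ {u x} → Adj G u x →
    HasPeriodicColouring G 2 k → k ≤ 2
  periodic₂-colours≤2 conn {u} {x} ux (c , surjective , periodic) = two-valued⇒≤2 colour-of-edge
    where
    colour-of-edge : ∀ y → y ≡ c u ⊎ y ≡ c x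
    colour-of-edge y with surjective y
    ... | w , cw≡y with colours-of-edge periodic conn ux w
    ...   | inj₁ cw≡cu = inj₁ (trans (sym (cw≡y refl)) cw≡cu)
    ...   | inj₂ cw≡cx = inj₂ (trans (sym (cw≡y refl)) cw≡cx)

  bipartite⇒χ₂≡2 : Connected G → ∀ {u x} → Adj G u x → Bipartite G → IsChi 2 G 2
  bipartite⇒χ₂≡2 conn ux (side , proper) =
    (colour , colour-surjective , colour-periodic) , λ _ → periodic₂-colours≤2 conn ux
    where
    open Inverse 2↔Bool using (from)

    colour : Fin n → Fin 2
    colour = from ∘ side

    colour-surjective : Surjective _≡_ _≡_ colour
    colour-surjective = Compose.surjective _≡_ _≡_ _≡_
      (≢⇒surjective (proper ux)) (Surjection.surjective (↔⇒↠ (↔-sym 2↔Bool)))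

    colour-periodic : Periodic G 2 colour
    colour-periodic p = cong from
      (≢-≢⇒≡ (proper (adj p zero)) (proper (SimpleGraph.sym G (adj p (suc zero)))))

  periodic₂-2-colouring⇒bipartite : Connected G → HasPeriodicColouring G 2 2 → Bipartite G
  periodic₂-2-colouring⇒bipartite conn (c , surjective , periodic) =
    to ∘ c , λ uv c-same → surjective⇒¬constant surjective
      (monochromatic-edge⇒constant periodic conn uv (to-injective c-same))
    where
    open Inverse 2↔Bool using (to)
    to-injective : Injective _≡_ _≡_ to
    to-injective = Injection.injective (↔⇒↣ 2↔Bool)

proposition4p4 : ∀ {n : ℕ} (G : SimpleGraph n) → Connected G →
    (∀ v → Σ (Path G 2) (λ p → start p ≡ v ⊎ end p ≡ v)) →
    (Bipartite G ⇔ IsChi 2 G 2)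
proposition4p4 {zero}  G (() , _) _
proposition4p4 {suc n} G conn on-path₂ =
  mk⇔ (bipartite⇒χ₂≡2 G conn edge) (periodic₂-2-colouring⇒bipartite G conn ∘ proj₁)
  where
  edge : Adj G _ _
  edge = adj (proj₁ (on-path₂ zero)) zero
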